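{- Let $G$ be a $\log$-maximal graph. Then $\delta(G)\ge d(G)/2$.
   Context: $\delta(G)$ is the minimum degree and $d(G)$ the average degree of $G$. A graph $G$ is $\log$-maximal if every subgraph $H$ of $G$ satisfies $d(H)/\log|V(H)|\le d(G)/\log|V(G)|$ (natural logarithm). -}

module Defs where

open import Data.Nat using (ℕ; zero; suc; _+_; _*_; _^_; _≤_)
open import Data.Bool using (Bool; true; false; if_then_else_)
open import Data.Fin using (Fin; zero; suc)
open import Relation.Binary.PropositionalEquality using (_≡_)
open import Function.Definitions using (Injective)

Σ-Fin : (n : ℕ) → (Fin n → ℕ) → ℕ
Σ-Fin zero    f = 0
Σ-Fin (suc n) f = f zero + Σ-Fin n (λ i → f (suc i))

record Graph (n : ℕ) : Set where
  field
    adj     : Fin n → Fin n → Bool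
    symm    : ∀ u v → adj u v ≡ adj v u
    irrefl  : ∀ v → adj v v ≡ false

open Graph public

deg : {n : ℕ} → Graph n → Fin n → ℕ
deg {n} G v = Σ-Fin n (λ u → if adj G v u then 1 else 0)

-- sum of degrees (= 2 |E(G)|); the average degree is d(G) = degSum G / n.
degSum : {n : ℕ} → Graph n → ℕ
degSum {n} G = Σ-Fin n (deg G)

-- H (on Fin m) is a subgraph of G (on Fin n): an injective vertex map
-- sending edges of H to edges of G (subgraph up to isomorphism).
record Subgraph {m n : ℕ} (H : Graph m) (G : Graph n) : Set where
  field
    emb     : Fin m → Fin n
    emb-inj : Injective _≡_ _≡_ emb
    emb-adj : ∀ u v → adj H u v ≡ true → adj G (emb u) (emb v) ≡ true

-- For 2 ≤ m and 2 ≤ n, with d(H) = sH/m and d(G) = sG/n: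
--   d(H)/ln m ≤ d(G)/ln n
--   ⇔ sH·n·ln n ≤ sG·m·ln m      (multiply by m·n·ln m·ln n > 0)
--   ⇔ n^(sH·n) ≤ m^(sG·m)        (exp is strictly monotone)
-- so the real-valued comparison is expressed exactly in ℕ.
LogRatio≤ : {m n : ℕ} → Graph m → Graph n → Set
LogRatio≤ {m} {n} H G = n ^ (degSum H * n) ≤ m ^ (degSum G * m)

-- G is log-maximal: every subgraph H (with |V(H)| ≥ 2, so that log|V(H)| > 0)
-- satisfies d(H)/log|V(H)| ≤ d(G)/log|V(G)|.
LogMaximal : {n : ℕ} → Graph n → Set
LogMaximal {n} G =
  (m : ℕ) → 2 ≤ m → (H : Graph m) → Subgraph H G → LogRatio≤ H G

-- δ(G) ≥ d(G)/2, i.e. every vertex v has deg v ≥ degSum G / (2n),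
-- i.e. 2·n·deg v ≥ degSum G.
MinDegAtLeastHalfAvg : {n : ℕ} → Graph n → Set
MinDegAtLeastHalfAvg {n} G = ∀ v → degSum G ≤ 2 * n * deg G v

{-# OPTIONS --safe #-}
-- Deleting a vertex v of G turns the degree sum s into s − 2·deg v, so if
-- deg v < d(G)/2 the remaining graph on n − 1 ≥ 2 vertices has strictly larger
-- average degree, and a strictly smaller vertex count, hence a strictly larger
-- ratio d/log — contradicting log-maximality. For n = 2 the remaining graph has
-- a single vertex and no edges, so the inequality holds trivially.
module Submission where

open import Defs
open import Data.Nat using (ℕ; zero; suc; _+_; _*_; _^_; _≤_; _<_; z≤n; s≤s; _≤?_; NonZero; >-nonZero⁻¹)
open import Data.Nat.Properties
open import Data.Nat.Tactic.RingSolver using (solve-∀)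
open import Data.Bool using (Bool; if_then_else_)
open import Data.Fin using (Fin; zero; suc; punchIn)
open import Data.Fin.Properties using (punchIn-injective)
open import Data.Vec.Functional using (removeAt)
open import Algebra.Properties.CommutativeMonoid.Sum +-0-commutativeMonoid
  using (sum; sum-cong-≗; sum-remove; ∑-distrib-+)
open import Relation.Binary.PropositionalEquality
open import Relation.Nullary using (yes; no; contradiction)

Σ-Fin≡sum : ∀ n (f : Fin n → ℕ) → Σ-Fin n f ≡ sum f
Σ-Fin≡sum zero    f = refl
Σ-Fin≡sum (suc n) f = cong (f zero +_) (Σ-Fin≡sum n (λ i → f (suc i)))

Σ-Fin-cong : ∀ n {f g : Fin n → ℕ} → (∀ i → f i ≡ g i) → Σ-Fin n f ≡ Σ-Fin n g
Σ-Fin-cong n {f} {g} f≗g = begin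
  Σ-Fin n f ≡⟨ Σ-Fin≡sum n f ⟩
  sum f     ≡⟨ sum-cong-≗ f≗g ⟩
  sum g     ≡⟨ Σ-Fin≡sum n g ⟨
  Σ-Fin n g ∎
  where open ≡-Reasoning

Σ-Fin-remove : ∀ n (f : Fin (suc n) → ℕ) i → Σ-Fin (suc n) f ≡ f i + Σ-Fin n (removeAt f i)
Σ-Fin-remove n f i = begin
  Σ-Fin (suc n) f                 ≡⟨ Σ-Fin≡sum (suc n) f ⟩
  sum f                           ≡⟨ sum-remove f ⟩
  f i + sum (removeAt f i)        ≡⟨ cong (f i +_) (Σ-Fin≡sum n (removeAt f i)) ⟨
  f i + Σ-Fin n (removeAt f i)    ∎
  where open ≡-Reasoning

Σ-Fin-distrib-+ : ∀ n (f g : Fin n → ℕ) → Σ-Fin n (λ i → f i + g i) ≡ Σ-Fin n f + Σ-Fin n g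
Σ-Fin-distrib-+ n f g = begin
  Σ-Fin n (λ i → f i + g i)  ≡⟨ Σ-Fin≡sum n _ ⟩
  sum (λ i → f i + g i)      ≡⟨ ∑-distrib-+ f g ⟩
  sum f + sum g              ≡⟨ cong₂ _+_ (Σ-Fin≡sum n f) (Σ-Fin≡sum n g) ⟨
  Σ-Fin n f + Σ-Fin n g      ∎
  where open ≡-Reasoning

indicator : Bool → ℕ
indicator b = if b then 1 else 0

removeVertex : ∀ {m} → Graph (suc m) → Fin (suc m) → Graph m
removeVertex G v = record
  { adj    = λ u w → adj G (punchIn v u) (punchIn v w)
  ; symm   = λ u w → symm G (punchIn v u) (punchIn v w)
  ; irrefl = λ u → irrefl G (punchIn v u)
  }

removeVertex-subgraph : ∀ {m} (G : Graph (suc m)) v → Subgraph (removeVertex G v) G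
removeVertex-subgraph G v = record
  { emb     = punchIn v
  ; emb-inj = punchIn-injective v _ _
  ; emb-adj = λ _ _ uw∈E → uw∈E
  }

deg-punchIn : ∀ {m} (G : Graph (suc m)) v u →
  deg G (punchIn v u) ≡ indicator (adj G (punchIn v u) v) + deg (removeVertex G v) u
deg-punchIn {m} G v u = Σ-Fin-remove m (λ w → indicator (adj G (punchIn v u) w)) v

deg≡Σ-adjacent-to : ∀ {m} (G : Graph (suc m)) v →
  deg G v ≡ Σ-Fin m (λ u → indicator (adj G (punchIn v u) v))
deg≡Σ-adjacent-to {m} G v = begin
  deg G v
    ≡⟨ Σ-Fin-remove m (λ w → indicator (adj G v w)) v ⟩
  indicator (adj G v v) + Σ-adjacent-from-v
    ≡⟨ cong (λ b → indicator b + Σ-adjacent-from-v) (irrefl G v) ⟩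
  Σ-adjacent-from-v
    ≡⟨ Σ-Fin-cong m (λ u → cong indicator (symm G v (punchIn v u))) ⟩
  Σ-Fin m (λ u → indicator (adj G (punchIn v u) v))
    ∎
  where
  open ≡-Reasoning
  Σ-adjacent-from-v : ℕ
  Σ-adjacent-from-v = Σ-Fin m (λ u → indicator (adj G v (punchIn v u)))

degSum-removeVertex : ∀ {m} (G : Graph (suc m)) v →
  degSum G ≡ degSum (removeVertex G v) + 2 * deg G v
degSum-removeVertex {m} G v = begin
  degSum G
    ≡⟨ Σ-Fin-remove m (deg G) v ⟩
  d + Σ-Fin m (λ u → deg G (punchIn v u))
    ≡⟨ cong (d +_) (Σ-Fin-cong m (deg-punchIn G v)) ⟩
  d + Σ-Fin m (λ u → indicator (adj G (punchIn v u) v) + deg H u)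
    ≡⟨ cong (d +_) (Σ-Fin-distrib-+ m _ (deg H)) ⟩
  d + (Σ-Fin m (λ u → indicator (adj G (punchIn v u) v)) + degSum H)
    ≡⟨ cong (λ e → d + (e + degSum H)) (deg≡Σ-adjacent-to G v) ⟨
  d + (d + degSum H)
    ≡⟨ rearrange d (degSum H) ⟩
  degSum H + 2 * d
    ∎
  where
  open ≡-Reasoning
  H : Graph m
  H = removeVertex G v
  d : ℕ
  d = deg G v
  rearrange : ∀ a b → a + (a + b) ≡ b + 2 * a
  rearrange = solve-∀

degSum-removeVertex-< : ∀ {m} (G : Graph (suc m)) v →
  2 * suc m * deg G v < degSum G → degSum G * m < degSum (removeVertex G v) * suc m
degSum-removeVertex-< {m} G v low rewrite degSum-removeVertex G v = begin-strict
  (t + 2 * d) * m   ≡⟨ *-distribʳ-+ m t (2 * d) ⟩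
  t * m + 2 * d * m <⟨ +-monoʳ-< (t * m) 2dm<t ⟩
  t * m + t         ≡⟨ *-suc-comm t m ⟨
  t * suc m         ∎
  where
  open ≤-Reasoning
  t : ℕ
  t = degSum (removeVertex G v)
  d : ℕ
  d = deg G v
  *-suc-comm : ∀ a b → a * suc b ≡ a * b + a
  *-suc-comm = solve-∀
  expand : ∀ a b → 2 * suc a * b ≡ 2 * b * a + 2 * b
  expand = solve-∀
  2dm<t : 2 * d * m < t
  2dm<t = +-cancelʳ-< (2 * d) (2 * d * m) t (subst (_< t + 2 * d) (expand m d) low)

LogRatio≤-removeVertex⇒ : ∀ {m} .{{_ : NonZero m}} (G : Graph (suc m)) v →
  LogRatio≤ (removeVertex G v) G → degSum G ≤ 2 * suc m * deg G v
LogRatio≤-removeVertex⇒ {m} G v ratio with degSum G ≤? 2 * suc m * deg G v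
... | yes s≤2nd = s≤2nd
... | no  s≰2nd = contradiction ratio (<⇒≱ (begin-strict
  m ^ (s * m)         ≤⟨ ^-monoˡ-≤ (s * m) (n≤1+n m) ⟩
  suc m ^ (s * m)     <⟨ ^-monoʳ-< (suc m) (s≤s (>-nonZero⁻¹ m)) (degSum-removeVertex-< G v (≰⇒> s≰2nd)) ⟩
  suc m ^ (t * suc m) ∎))
  where
  open ≤-Reasoning
  s : ℕ
  s = degSum G
  t : ℕ
  t = degSum (removeVertex G v)

degSum-singleton : (H : Graph 1) → degSum H ≡ 0
degSum-singleton H rewrite irrefl H zero = refl

LogRatio≤-singleton : ∀ {n} (H : Graph 1) (G : Graph n) → LogRatio≤ H G
LogRatio≤-singleton H G rewrite degSum-singleton H = m^n>0 1 (degSum G * 1)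

lemma3p4 : (n : ℕ) → 2 ≤ n → (G : Graph n) → LogMaximal G → MinDegAtLeastHalfAvg G
lemma3p4 (suc zero) (s≤s ())
lemma3p4 (suc (suc zero)) _ G _ v =
  LogRatio≤-removeVertex⇒ G v (LogRatio≤-singleton (removeVertex G v) G)
lemma3p4 (suc (suc (suc k))) _ G logMaximal v =
  LogRatio≤-removeVertex⇒ G v (logMaximal _ (s≤s (s≤s z≤n)) _ (removeVertex-subgraph G v))
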